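{- Let $A\subseteq\mathbb{N}$, let $F\subset\mathbb{N}$ be a non-empty finite set, and let $S\subseteq\mathbb{N}$ be multiplicatively $F$-syndetic. Let $\mathcal{S}$ be a dilation invariant finite system of equations and let $r\in\mathbb{N}$. If $\mathcal{S}$ is $(|F|\cdot r)$-regular over $A$, then $\mathcal{S}$ is $r$-regular over $S\cap(F\cdot A)$, where $F\cdot A=\{ta:t\in F,\ a\in A\}$.
   Context: $\mathbb{N}=\{1,2,3,\dots\}$. A finite system of equations $\mathcal{S}$ in $s$ variables consists of finitely many equations $p_i(t_1,\dots,t_s)=0$ with $p_i\in\mathbb{Q}[t_1,\dots,t_s]$. A solution is $\mathbf{x}\in\mathbb{N}^s$ satisfying all equations; it is non-trivial if its entries are not all equal. $\mathcal{S}$ is dilation invariant if whenever $\mathbf{x}$ is a solution, $\lambda\mathbf{x}$ also satisfies all equations for every $\lambda\in\mathbb{Q}$. For $B\subseteq\mathbb{N}$ and $k\in\mathbb{N}$, $\mathcal{S}$ is $k$-regular over $B$ if for every colouring of $B$ with $k$ colours there exists a monochromatic non-trivial solution with all entries in $B$. $S\subseteq\mathbb{N}$ is multiplicatively $F$-syndetic if for every $n\in\mathbb{N}$ there is $t\in F$ with $nt\in S$. -}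

module Defs where

open import Data.Nat using (ℕ; zero; suc; _*_; _≤_)
open import Data.Fin using (Fin)
import Data.Fin as Fin
open import Data.List using (List; []; _∷_; length)
open import Data.List.Membership.Propositional using (_∈_)
open import Data.List.Relation.Unary.All using (All)
open import Data.List.Relation.Unary.Unique.Propositional using (Unique)
open import Data.Integer using (+_)
open import Data.Rational using (ℚ; 0ℚ; 1ℚ; _/_)
import Data.Rational as Q
open import Data.Product using (Σ; _×_; ∃; ∃-syntax; _,_)
open import Relation.Binary.PropositionalEquality using (_≡_; _≢_)
open import Relation.Unary using (Pred; _∩_)
open import Level using (0ℓ)

-- Subsets of ℕ = {1,2,3,...} are predicates on Agda's ℕ (which contains 0)
-- together with an explicit positivity hypothesis where relevant.
Positive : Pred ℕ 0ℓ → Set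
Positive B = ∀ n → B n → 1 ≤ n

toℚ : ℕ → ℚ
toℚ n = + n / 1

_^ℚ_ : ℚ → ℕ → ℚ
q ^ℚ zero = 1ℚ
q ^ℚ suc n = q Q.* (q ^ℚ n)

prodFin : ∀ {s} → (Fin s → ℚ) → ℚ
prodFin {zero} f = 1ℚ
prodFin {suc s} f = f Fin.zero Q.* prodFin (λ i → f (Fin.suc i))

-- A polynomial in ℚ[t₁,…,t_s]: a finite list of monomials
-- (coefficient, exponent vector).
Monomial : ℕ → Set
Monomial s = ℚ × (Fin s → ℕ)

Poly : ℕ → Set
Poly s = List (Monomial s)

evalMono : ∀ {s} → Monomial s → (Fin s → ℚ) → ℚ
evalMono (c , e) x = c Q.* prodFin (λ i → x i ^ℚ e i)

eval : ∀ {s} → Poly s → (Fin s → ℚ) → ℚ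
eval [] x = 0ℚ
eval (m ∷ p) x = evalMono m x Q.+ eval p x

System : ℕ → Set
System s = List (Poly s)

Satisfies : ∀ {s} → System s → (Fin s → ℚ) → Set
Satisfies 𝒮 x = All (λ p → eval p x ≡ 0ℚ) 𝒮

embed : ∀ {s} → (Fin s → ℕ) → (Fin s → ℚ)
embed x i = toℚ (x i)

IsSolution : ∀ {s} → System s → (Fin s → ℕ) → Set
IsSolution 𝒮 x = (∀ i → 1 ≤ x i) × Satisfies 𝒮 (embed x)

NonTrivial : ∀ {s} → (Fin s → ℕ) → Set
NonTrivial {s} x = ∃[ i ] ∃[ j ] (x i ≢ x j)

DilationInvariant : ∀ {s} → System s → Set
DilationInvariant 𝒮 =
  ∀ x → IsSolution 𝒮 x → ∀ (λ' : ℚ) → Satisfies 𝒮 (λ i → λ' Q.* embed x i)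

-- A colouring of B is
-- represented by a function ℕ → Fin k (only its values on B matter).
Regular : ∀ {s} → System s → ℕ → Pred ℕ 0ℓ → Set
Regular {s} 𝒮 k B =
  (c : ℕ → Fin k) →
  ∃[ x ] (IsSolution 𝒮 x × NonTrivial x × (∀ i → B (x i))
          × ∃[ col ] (∀ i → c (x i) ≡ col))

-- F finite set of positive integers, given as a duplicate-free list;
-- |F| = length.
FinSet : List ℕ → Set
FinSet F = Unique F × All (λ t → 1 ≤ t) F

MultSyndetic : List ℕ → Pred ℕ 0ℓ → Set
MultSyndetic F S = ∀ n → 1 ≤ n → ∃[ t ] (t ∈ F × S (n * t))

_·_ : List ℕ → Pred ℕ 0ℓ → Pred ℕ 0ℓ
(F · A) n = ∃[ t ] ∃[ a ] (t ∈ F × A a × n ≡ t * a)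

-- Refine an r-colouring c into an |F|·r-colouring of A by giving a the pair
-- (t, c (t a)), where t ∈ F is chosen with t a ∈ S.  A monochromatic
-- non-trivial solution x over A then has a common factor t, and by dilation
-- invariance t x is a non-trivial solution in S ∩ F·A on which c is constant.
module Submission where

open import Defs
open import Data.Nat using (ℕ; zero; suc; _*_; _≤_; s≤s; z≤n; >-nonZero)
open import Data.Nat.Properties using (*-mono-≤; *-comm; *-cancelʳ-≡)
open import Data.Nat.Coprimality using (1-coprimeTo)
import Data.Nat.Coprimality as Coprime
open import Data.Integer.Properties using (pos-*)
open import Data.Rational using (ℚ)
import Data.Rational as Q
import Data.Rational.Properties as Q
open import Data.Fin using (Fin; combine)
import Data.Fin as Fin
open import Data.Fin.Properties using (combine-injective)
open import Data.List using (List; []; _∷_; length; lookup)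
open import Data.List.Membership.Propositional using (_∈_)
open import Data.List.Relation.Unary.Any using (here; index)
open import Data.List.Relation.Unary.Any.Properties using (lookup-index)
open import Data.List.Relation.Unary.All using (All)
import Data.List.Relation.Unary.All as All
open import Data.Empty using (⊥-elim)
open import Data.Product using (∃-syntax; _×_; _,_; proj₁; proj₂)
open import Relation.Binary.PropositionalEquality
  using (_≡_; _≢_; _≗_; refl; sym; trans; cong; cong₂; subst)
open import Relation.Unary using (Pred; _∩_)
open import Level using (0ℓ)

-- Once toℚ m and toℚ n are rewritten to their normal forms mkℚ (+ _) 0 _,
-- the product on the right computes to + m ℤ.* + n / 1.
toℚ-* : ∀ m n → toℚ (m * n) ≡ toℚ m Q.* toℚ n
toℚ-* m n
  rewrite Q.normalize-coprime (Coprime.sym (1-coprimeTo m))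
        | Q.normalize-coprime (Coprime.sym (1-coprimeTo n))
  = cong (Q._/ 1) (pos-* m n)

prodFin-cong : ∀ {s} {f g : Fin s → ℚ} → f ≗ g → prodFin f ≡ prodFin g
prodFin-cong {zero}  f≗g = refl
prodFin-cong {suc s} f≗g = cong₂ Q._*_ (f≗g Fin.zero) (prodFin-cong (λ i → f≗g (Fin.suc i)))

eval-cong : ∀ {s} (p : Poly s) {f g : Fin s → ℚ} → f ≗ g → eval p f ≡ eval p g
eval-cong []             f≗g = refl
eval-cong ((c , e) ∷ p) f≗g =
  cong₂ Q._+_ (cong (c Q.*_) (prodFin-cong (λ i → cong (_^ℚ e i) (f≗g i)))) (eval-cong p f≗g)

Satisfies-cong : ∀ {s} (𝒮 : System s) {f g : Fin s → ℚ} → f ≗ g → Satisfies 𝒮 f → Satisfies 𝒮 g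
Satisfies-cong 𝒮 f≗g = All.map (λ {p} p[f]≡0 → trans (sym (eval-cong p f≗g)) p[f]≡0)

_*ᵛ_ : ∀ {s} → (Fin s → ℕ) → ℕ → Fin s → ℕ
(x *ᵛ t) i = x i * t

IsSolution-*ᵛ : ∀ {s} {𝒮 : System s} {x t} →
                DilationInvariant 𝒮 → IsSolution 𝒮 x → 1 ≤ t → IsSolution 𝒮 (x *ᵛ t)
IsSolution-*ᵛ {𝒮 = 𝒮} {x} {t} dil x-sol@(x-pos , _) t-pos =
  (λ i → *-mono-≤ (x-pos i) t-pos) ,
  Satisfies-cong 𝒮 (λ i → trans (Q.*-comm (toℚ t) (toℚ (x i))) (sym (toℚ-* (x i) t)))
                 (dil x x-sol (toℚ t))

NonTrivial-*ᵛ : ∀ {s} {x : Fin s → ℕ} {t} → 1 ≤ t → NonTrivial x → NonTrivial (x *ᵛ t)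
NonTrivial-*ᵛ {x = x} {t} t-pos (i , j , xi≢xj) =
  i , j , λ xit≡xjt → xi≢xj (*-cancelʳ-≡ (x i) (x j) t ⦃ >-nonZero t-pos ⦄ xit≡xjt)

nonempty-∈ : ∀ {F : List ℕ} → F ≢ [] → ∃[ t ] t ∈ F
nonempty-∈ {[]}    F≢[] = ⊥-elim (F≢[] refl)
nonempty-∈ {t ∷ _} _    = t , here refl

-- 0 is not in the paper's ℕ, so factor 0 is just the given default t₀.
module SyndeticFactor {F : List ℕ} {S : Pred ℕ 0ℓ} (syn : MultSyndetic F S)
                      {t₀ : ℕ} (t₀∈F : t₀ ∈ F) where

  factor : ℕ → ℕ
  factor zero    = t₀
  factor (suc n) = proj₁ (syn (suc n) (s≤s z≤n))

  factor∈F : ∀ n → factor n ∈ F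
  factor∈F zero    = t₀∈F
  factor∈F (suc n) = proj₁ (proj₂ (syn (suc n) (s≤s z≤n)))

  S-*factor : ∀ {n} → 1 ≤ n → S (n * factor n)
  S-*factor {suc n} _ = proj₂ (proj₂ (syn (suc n) (s≤s z≤n)))

MonochromaticSolution : ∀ {s k} → System s → (ℕ → Fin k) → Pred ℕ 0ℓ → Set
MonochromaticSolution 𝒮 c B =
  ∃[ x ] (IsSolution 𝒮 x × NonTrivial x × (∀ i → B (x i)) × ∃[ col ] (∀ i → c (x i) ≡ col))

module Refinement {F : List ℕ} {r : ℕ} (factor : ℕ → ℕ) (factor∈F : ∀ n → factor n ∈ F)
                  (c : ℕ → Fin r) where

  refined : ℕ → Fin (length F * r)
  refined n = combine (index (factor∈F n)) (c (n * factor n))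

  refined-injective : ∀ {m n} → refined m ≡ refined n →
                      factor m ≡ factor n × c (m * factor m) ≡ c (n * factor n)
  refined-injective {m} {n} eq with index≡ , c≡ ← combine-injective _ _ _ _ eq =
    trans (lookup-index (factor∈F m))
          (trans (cong (lookup F) index≡) (sym (lookup-index (factor∈F n)))) ,
    c≡

  refined-monochromatic : ∀ {s} (x : Fin s → ℕ) {col} → (∀ i → refined (x i) ≡ col) →
                          ∀ j i → factor (x i) ≡ factor (x j)
                                × c (x i * factor (x j)) ≡ c (x j * factor (x j))
  refined-monochromatic x mono j i
    with factor≡ , c≡ ← refined-injective (trans (mono i) (sym (mono j))) =
    factor≡ , trans (cong (λ t → c (x i * t)) (sym factor≡)) c≡

  rescale : ∀ {s} {𝒮 : System s} {A S : Pred ℕ 0ℓ} →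
            All (1 ≤_) F → (∀ {n} → 1 ≤ n → S (n * factor n)) → DilationInvariant 𝒮 →
            MonochromaticSolution 𝒮 refined A → MonochromaticSolution 𝒮 c (S ∩ (F · A))
  rescale {S = S} F-pos S-*factor dil (x , x-sol , x-nt@(j , _) , x∈A , _ , x-mono) =
    x *ᵛ t , IsSolution-*ᵛ dil x-sol t-pos , NonTrivial-*ᵛ t-pos x-nt ,
    (λ i → S-xt i , t , x i , factor∈F (x j) , x∈A i , *-comm (x i) t) ,
    c (x j * t) , λ i → proj₂ (same i)
    where
    t : ℕ
    t = factor (x j)
    t-pos : 1 ≤ t
    t-pos = All.lookup F-pos (factor∈F (x j))
    same : ∀ i → factor (x i) ≡ t × c (x i * t) ≡ c (x j * t)
    same = refined-monochromatic x x-mono j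
    S-xt : ∀ i → S (x i * t)
    S-xt i = subst (λ u → S (x i * u)) (proj₁ (same i)) (S-*factor (proj₁ x-sol i))

proposition2p3 : (s : ℕ) (A S : Pred ℕ 0ℓ) (F : List ℕ) (𝒮 : System s) (r : ℕ)
    → Positive A → Positive S → FinSet F → F ≢ [] → 1 ≤ r
    → MultSyndetic F S → DilationInvariant 𝒮
    → Regular 𝒮 (length F * r) A
    → Regular 𝒮 r (S ∩ (F · A))
proposition2p3 s A S F 𝒮 r _ _ (_ , F-pos) F≢[] _ syn dil reg c =
  rescale {S = S} F-pos S-*factor dil (reg refined)
  where
  open SyndeticFactor {S = S} syn (proj₂ (nonempty-∈ F≢[]))
  open Refinement factor factor∈F c
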